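{- Let $A=\{a,b\}$ and let $A^*$ be ordered by factor order. Define $f$ on words as follows: for $w=w(1)\ldots w(n-1)\in A^*$ (with $n\ge1$), build $f(w)\in S_n$ by going through $i=1,\dots,n-1$ and setting $f(w)(i)$ to be the smallest number of $\{1,\dots,n\}$ not yet used if $w(i)=a$, and the largest such number if $w(i)=b$; finally $f(w)(n)$ is the single unused number. Then $f$ is an isomorphism of posets from $A^*$ (in factor order) onto the subposet of the consecutive pattern poset $S$ consisting of all permutations that avoid the (classical) patterns $213$ and $231$.
   Context: For a set $A$, $A^*$ is the set of all finite words (including the empty word) over $A$. Factor order: $u\le w$ iff $u$ occurs as a block of consecutive letters in $w$, i.e. $u(j)=w(i+j)$ for $1\le j\le|u|$ for some $i$. For $d\ge1$, $S_d$ is the set of permutations of $\{1,\dots,d\}$ in one-line notation and $S=\bigcup_{d>0}S_d$. The standard form of a sequence of distinct integers is the permutation whose entries are in the same relative order. The consecutive pattern poset orders $S$ by $\sigma\le\tau$ ($\sigma\in S_k$) iff the standard form of $\tau(i+1)\ldots\tau(i+k)$ equals $\sigma$ for some $i$. A permutation $\pi$ avoids a classical pattern $p\in S_3$ if no subsequence (not necessarily consecutive) of three entries of $\pi$ has standard form $p$. -}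

module Defs where

open import Data.Nat using (ℕ; zero; suc; pred; _<_; _<?_)
open import Data.List using (List; []; _∷_; _++_; length; map; upTo; filter)
open import Data.List.Relation.Binary.Permutation.Propositional using (_↭_)
open import Data.List.Relation.Binary.Sublist.Propositional using (_⊆_)
open import Data.Product using (Σ; ∃; _×_)
open import Relation.Binary.PropositionalEquality using (_≡_)
open import Relation.Nullary using (¬_)

data Letter : Set where
  a b : Letter

Word : Set
Word = List Letter

_≤F_ : Word → Word → Set
u ≤F w = Σ Word λ p → Σ Word λ s → w ≡ p ++ (u ++ s)

-- Permutations in one-line notation: a list of naturals that is a
-- rearrangement of 1, 2, ..., d where d is its length.
IsPerm : List ℕ → Set
IsPerm π = π ↭ map suc (upTo (length π))

InS : List ℕ → Set
InS π = IsPerm π × (0 < length π)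

std : List ℕ → List ℕ
std xs = map (λ x → suc (length (filter (_<? x) xs))) xs

_≤C_ : List ℕ → List ℕ → Set
σ ≤C τ = Σ (List ℕ) λ p → Σ (List ℕ) λ m → Σ (List ℕ) λ s →
           (τ ≡ p ++ (m ++ s)) × (std m ≡ σ)

Avoids : List ℕ → List ℕ → Set
Avoids π p = ¬ (Σ (List ℕ) λ xs → (xs ⊆ π) × (std xs ≡ p))

-- The map f.  The set of unused numbers is always an interval [lo, hi];
-- letter a takes the smallest unused number, b the largest; at the end
-- the single unused number lo (= hi) is appended.
fAux : Word → ℕ → ℕ → List ℕ
fAux []      lo hi = lo ∷ []
fAux (a ∷ w) lo hi = lo ∷ fAux w (suc lo) hi
fAux (b ∷ w) lo hi = hi ∷ fAux w lo (pred hi)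

-- For |w| = n - 1, f w ∈ S_n uses the numbers {1, ..., n}.
f : Word → List ℕ
f w = fAux w 1 (suc (length w))

p213 p231 : List ℕ
p213 = 2 ∷ 1 ∷ 3 ∷ []
p231 = 2 ∷ 3 ∷ 1 ∷ []

InAv : List ℕ → Set
InAv π = InS π × Avoids π p213 × Avoids π p231

module Submission where

-- Call a list m of numbers SHAPED by a word u (Shape u m) if,
-- reading m from left to right, each entry is smaller than all later entries
-- when the corresponding letter of u is a, and larger than all later entries
-- when it is b (the last entry corresponds to the end of u).  Everything
-- follows from four facts about this notion:
--   * f w is a permutation of 1..n, and it is shaped by w;
--   * a shaped list determines its word, and its standard form is f of it;
--   * the factors of w correspond exactly to the blocks of consecutive
--     entries of a list shaped by w, with matching shapes;
--   * the first entry of a 213- and 231-avoider of an interval is the least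
--     or the largest element, which rebuilds the word letter by letter.
-- From these: every subsequence of f w starts at its minimum or maximum, so
-- f w avoids 213 and 231; f is injective; f is onto the avoiders; and
-- u ≤ w in factor order iff f u ≤ f w in consecutive pattern order.

open import Defs
open import Data.Nat using (ℕ; zero; suc; pred; _+_; _≤_; _<_; _<?_; z≤n; s≤s; s≤s⁻¹; _≟_)
open import Data.Nat.Properties
  using (+-suc; +-identityʳ; ≤-refl; ≤-trans; <-irrefl; <-asym; <-trans; <⇒≤; <⇒≢; ≤∧≢⇒<;
         m<m+n; m≤m+n; n<1+n; +-monoʳ-<)
open import Data.List using (List; []; _∷_; _++_; length; map; upTo; applyUpTo; filter; [_])
open import Data.List.Properties
  using (map-applyUpTo; map-cong-local; map-∘; length-map; ∷-injectiveˡ; ∷-injectiveʳ;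
         filter-accept; filter-reject; filter-all; filter-none; ++-identityʳ; ++-conicalʳ)
open import Data.List.Relation.Unary.All as All using (All; []; _∷_)
open import Data.List.Relation.Unary.All.Properties using (++⁻ˡ)
open import Data.List.Relation.Unary.Any using (here; there)
open import Data.List.Membership.Propositional using (_∈_)
open import Data.List.Relation.Binary.Permutation.Propositional
  using (_↭_; ↭-refl; ↭-sym; module PermutationReasoning)
open import Data.List.Relation.Binary.Permutation.Propositional.Properties
  using (drop-mid; drop-∷; ↭-length; ↭-singleton-inv; ∈-resp-↭; ++-comm)
open import Data.List.Relation.Binary.Sublist.Propositional
  using (_⊆_; []; _∷_; _∷ʳ_; from∈; ⊆-refl; ⊆-trans)
open import Data.List.Relation.Binary.Sublist.Propositional.Properties using (All-resp-⊆)
open import Data.Product using (Σ; _×_; _,_; proj₁; proj₂)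
open import Data.Sum using (_⊎_; inj₁; inj₂)
open import Data.Empty using (⊥; ⊥-elim)
open import Function.Base using (_∘_)
open import Function.Bundles using (_⇔_; mk⇔)
open import Relation.Nullary using (¬_; yes; no)
open import Relation.Binary.PropositionalEquality
  using (_≡_; _≢_; ≢-sym; refl; sym; trans; cong; cong₂; subst; module ≡-Reasoning)

range : ℕ → ℕ → List ℕ
range lo zero    = []
range lo (suc n) = lo ∷ range (suc lo) n

applyUpTo-range : ∀ n lo (g : ℕ → ℕ) → (∀ i → g i ≡ lo + i) → applyUpTo g n ≡ range lo n
applyUpTo-range zero    lo g g≗ = refl
applyUpTo-range (suc n) lo g g≗ =
  cong₂ _∷_ (trans (g≗ 0) (+-identityʳ lo))
            (applyUpTo-range n (suc lo) (λ i → g (suc i)) (λ i → trans (g≗ (suc i)) (+-suc lo i)))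

upTo-range : ∀ n → map suc (upTo n) ≡ range 1 n
upTo-range n = trans (map-applyUpTo (λ i → i) suc n) (applyUpTo-range n 1 suc (λ i → refl))

range-snoc : ∀ lo n → range lo (suc n) ≡ range lo n ++ [ lo + n ]
range-snoc lo zero    = cong [_] (sym (+-identityʳ lo))
range-snoc lo (suc n) = cong (lo ∷_)
  (trans (range-snoc (suc lo) n) (cong (λ t → range (suc lo) n ++ [ t ]) (sym (+-suc lo n))))

range-∈ : ∀ {y} lo n → y ∈ range lo n → lo ≤ y × y < lo + n
range-∈ lo (suc n) (here refl) = ≤-refl , m<m+n lo (s≤s z≤n)
range-∈ {y} lo (suc n) (there y∈) with range-∈ (suc lo) n y∈
... | lo<y , y<top = <⇒≤ lo<y , subst (y <_) (sym (+-suc lo n)) y<top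

∈-range : ∀ {y} lo n → lo ≤ y → y < lo + n → y ∈ range lo n
∈-range {y} lo zero    lo≤y y<top =
  ⊥-elim (<-irrefl refl (≤-trans y<top (subst (_≤ y) (sym (+-identityʳ lo)) lo≤y)))
∈-range {y} lo (suc n) lo≤y y<top with lo ≟ y
... | yes refl = here refl
... | no lo≢y  = there (∈-range (suc lo) n (≤∧≢⇒< lo≤y lo≢y) (subst (y <_) (+-suc lo n) y<top))

drop-last : ∀ {x : ℕ} {xs ys} → x ∷ xs ↭ ys ++ [ x ] → xs ↭ ys
drop-last {ys = ys} p = subst (_ ↭_) (++-identityʳ ys) (drop-mid [] ys p)

F : Word → ℕ → List ℕ
F w lo = fAux w lo (lo + length w)

F-a : ∀ w lo → F (a ∷ w) lo ≡ lo ∷ F w (suc lo)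
F-a w lo = cong (λ hi → lo ∷ fAux w (suc lo) hi) (+-suc lo (length w))

F-b : ∀ w lo → F (b ∷ w) lo ≡ lo + suc (length w) ∷ F w lo
F-b w lo = cong (λ hi → lo + suc (length w) ∷ fAux w lo (pred hi)) (+-suc lo (length w))

length-fAux : ∀ w lo hi → length (fAux w lo hi) ≡ suc (length w)
length-fAux []      lo hi = refl
length-fAux (a ∷ w) lo hi = cong suc (length-fAux w (suc lo) hi)
length-fAux (b ∷ w) lo hi = cong suc (length-fAux w lo (pred hi))

F-perm : ∀ w lo → F w lo ↭ range lo (suc (length w))
F-perm []      lo = ↭-refl
F-perm (a ∷ w) lo = begin
  F (a ∷ w) lo                       ≡⟨ F-a w lo ⟩
  lo ∷ F w (suc lo)                  <⟨ F-perm w (suc lo) ⟩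
  range lo (suc (suc (length w)))    ∎
  where open PermutationReasoning
F-perm (b ∷ w) lo = begin
  F (b ∷ w) lo                       ≡⟨ F-b w lo ⟩
  top ∷ F w lo                       <⟨ F-perm w lo ⟩
  [ top ] ++ range lo (suc (length w))  ↭⟨ ++-comm [ top ] (range lo (suc (length w))) ⟩
  range lo (suc (length w)) ++ [ top ]  ≡⟨ range-snoc lo (suc (length w)) ⟨
  range lo (suc (suc (length w)))    ∎
  where
  open PermutationReasoning
  top = lo + suc (length w)

F-bounds : ∀ w lo → All (λ y → lo ≤ y × y < lo + suc (length w)) (F w lo)
F-bounds w lo = All.tabulate (λ y∈ → range-∈ lo _ (∈-resp-↭ (F-perm w lo) y∈))

F-shift : ∀ w lo → F w (suc lo) ≡ map suc (F w lo)
F-shift []      lo = refl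
F-shift (a ∷ w) lo = begin
  F (a ∷ w) (suc lo)             ≡⟨ F-a w (suc lo) ⟩
  suc lo ∷ F w (suc (suc lo))    ≡⟨ cong (suc lo ∷_) (F-shift w (suc lo)) ⟩
  suc lo ∷ map suc (F w (suc lo)) ≡⟨ cong (map suc) (F-a w lo) ⟨
  map suc (F (a ∷ w) lo)         ∎
  where open ≡-Reasoning
F-shift (b ∷ w) lo = begin
  F (b ∷ w) (suc lo)                         ≡⟨ F-b w (suc lo) ⟩
  suc lo + suc (length w) ∷ F w (suc lo)     ≡⟨ cong (suc lo + suc (length w) ∷_) (F-shift w lo) ⟩
  suc (lo + suc (length w)) ∷ map suc (F w lo) ≡⟨ cong (map suc) (F-b w lo) ⟨
  map suc (F (b ∷ w) lo)                     ∎
  where open ≡-Reasoning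

rank : ℕ → List ℕ → ℕ
rank v xs = length (filter (_<? v) xs)

rank-< : ∀ {y} v ys → y < v → rank v (y ∷ ys) ≡ suc (rank v ys)
rank-< v ys y<v = cong length (filter-accept (_<? _) y<v)

rank-≮ : ∀ {y} v ys → ¬ y < v → rank v (y ∷ ys) ≡ rank v ys
rank-≮ v ys y≮v = cong length (filter-reject (_<? _) y≮v)

rank-none : ∀ v {ys} → All (λ y → ¬ y < v) ys → rank v ys ≡ 0
rank-none v none = cong length (filter-none (_<? _) none)

rank-all : ∀ v {ys} → All (_< v) ys → rank v ys ≡ length ys
rank-all v all = cong length (filter-all (_<? _) all)

std-least-head : ∀ x m → All (x <_) m → std (x ∷ m) ≡ 1 ∷ map suc (std m)
std-least-head x m x<m = cong₂ _∷_
  (cong suc (rank-none x (<-irrefl refl ∷ All.map <-asym x<m)))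
  (trans (map-cong-local (All.map (λ x<y → cong suc (rank-< _ m x<y)) x<m)) (map-∘ m))

std-greatest-head : ∀ x m → All (_< x) m → std (x ∷ m) ≡ suc (length m) ∷ std m
std-greatest-head x m m<x = cong₂ _∷_
  (cong suc (trans (rank-≮ x m (<-irrefl refl)) (rank-all x m<x)))
  (map-cong-local (All.map (λ y<x → cong suc (rank-≮ _ m (<-asym y<x))) m<x))

std-triple : ∀ x y z {i j k} → let t = x ∷ y ∷ z ∷ [] in
             rank x t ≡ i → rank y t ≡ j → rank z t ≡ k → std t ≡ suc i ∷ suc j ∷ suc k ∷ []
std-triple x y z rx ry rz = cong₂ _∷_ (cong suc rx) (cong₂ _∷_ (cong suc ry) (cong₂ _∷_ (cong suc rz) refl))

std-213 : ∀ {x y z} → y < x → x < z → std (x ∷ y ∷ z ∷ []) ≡ p213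
std-213 {x} {y} {z} y<x x<z = std-triple x y z
  (trans (rank-≮ x (y ∷ z ∷ []) (<-irrefl refl))
    (trans (rank-< x (z ∷ []) y<x) (cong suc (rank-none x (<-asym x<z ∷ [])))))
  (rank-none y (<-asym y<x ∷ <-irrefl refl ∷ <-asym y<z ∷ []))
  (trans (rank-< z (y ∷ z ∷ []) x<z)
    (cong suc (trans (rank-< z (z ∷ []) y<z) (cong suc (rank-none z (<-irrefl refl ∷ []))))))
  where y<z = <-trans y<x x<z

std-231 : ∀ {x y z} → z < x → x < y → std (x ∷ y ∷ z ∷ []) ≡ p231
std-231 {x} {y} {z} z<x x<y = std-triple x y z
  (trans (rank-≮ x (y ∷ z ∷ []) (<-irrefl refl))
    (trans (rank-≮ x (z ∷ []) (<-asym x<y)) (rank-all x (z<x ∷ []))))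
  (trans (rank-< y (y ∷ z ∷ []) x<y)
    (cong suc (trans (rank-≮ y (z ∷ []) (<-irrefl refl)) (rank-all y (z<y ∷ [])))))
  (rank-none z (<-asym z<x ∷ <-asym z<y ∷ <-irrefl refl ∷ []))
  where z<y = <-trans z<x x<y

data Shape : Word → List ℕ → Set where
  end      : ∀ x → Shape [] (x ∷ [])
  least    : ∀ {u x m} → All (x <_) m → Shape u m → Shape (a ∷ u) (x ∷ m)
  greatest : ∀ {u x m} → All (_< x) m → Shape u m → Shape (b ∷ u) (x ∷ m)

shape-length : ∀ {u m} → Shape u m → length m ≡ suc (length u)
shape-length (end x)        = refl
shape-length (least _ s)    = cong suc (shape-length s)
shape-length (greatest _ s) = cong suc (shape-length s)

shape-F : ∀ w lo → Shape w (F w lo)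
shape-F []      lo = end lo
shape-F (a ∷ w) lo = subst (Shape (a ∷ w)) (sym (F-a w lo))
  (least (All.map proj₁ (F-bounds w (suc lo))) (shape-F w (suc lo)))
shape-F (b ∷ w) lo = subst (Shape (b ∷ w)) (sym (F-b w lo))
  (greatest (All.map proj₂ (F-bounds w lo)) (shape-F w lo))

shape-f : ∀ w → Shape w (f w)
shape-f w = shape-F w 1

-- A list has at most one shape: an entry followed by others cannot be both
-- below and above them.
shape-unique : ∀ {u w m} → Shape u m → Shape w m → u ≡ w
shape-unique (end x)               (end x)                = refl
shape-unique (least _ s)           (least _ t)            = cong (a ∷_) (shape-unique s t)
shape-unique (greatest _ s)        (greatest _ t)         = cong (b ∷_) (shape-unique s t)
shape-unique (least (x<y ∷ _) _)   (greatest (y<x ∷ _) _) = ⊥-elim (<-asym x<y y<x)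
shape-unique (greatest (y<x ∷ _) _) (least (x<y ∷ _) _)   = ⊥-elim (<-asym x<y y<x)

std-shape : ∀ {u m} → Shape u m → std m ≡ f u
std-shape (end x) = cong (λ r → suc r ∷ []) (rank-≮ x [] (<-irrefl refl))
std-shape {a ∷ u} {x ∷ m} (least x<m s) = begin
  std (x ∷ m)              ≡⟨ std-least-head x m x<m ⟩
  1 ∷ map suc (std m)      ≡⟨ cong (λ r → 1 ∷ map suc r) (std-shape s) ⟩
  1 ∷ map suc (f u)        ≡⟨ cong (1 ∷_) (F-shift u 1) ⟨
  f (a ∷ u)                ∎
  where open ≡-Reasoning
std-shape {b ∷ u} {x ∷ m} (greatest m<x s) = begin
  std (x ∷ m)              ≡⟨ std-greatest-head x m m<x ⟩
  suc (length m) ∷ std m   ≡⟨ cong₂ _∷_ (cong suc (shape-length s)) (std-shape s) ⟩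
  f (b ∷ u)                ∎
  where open ≡-Reasoning

shape-drop-prefix : ∀ p {v m} → Shape (p ++ v) m →
                    Σ (List ℕ) λ P → Σ (List ℕ) λ m′ → (m ≡ P ++ m′) × Shape v m′
shape-drop-prefix []      s = [] , _ , refl , s
shape-drop-prefix (_ ∷ p) (least _ s)    with shape-drop-prefix p s
... | P , m′ , refl , s′ = _ ∷ P , m′ , refl , s′
shape-drop-prefix (_ ∷ p) (greatest _ s) with shape-drop-prefix p s
... | P , m′ , refl , s′ = _ ∷ P , m′ , refl , s′

shape-take-prefix : ∀ u {s m} → Shape (u ++ s) m →
                    Σ (List ℕ) λ M → Σ (List ℕ) λ S → (m ≡ M ++ S) × Shape u M
shape-take-prefix [] {m = x ∷ m} _ = x ∷ [] , m , refl , end x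
shape-take-prefix (_ ∷ u) (least x<m s)    with shape-take-prefix u s
... | M , S , refl , t = _ ∷ M , S , refl , least (++⁻ˡ M x<m) t
shape-take-prefix (_ ∷ u) (greatest m<x s) with shape-take-prefix u s
... | M , S , refl , t = _ ∷ M , S , refl , greatest (++⁻ˡ M m<x) t

factor⇒block : ∀ {u w m} → Shape w m → u ≤F w →
               Σ (List ℕ) λ P → Σ (List ℕ) λ M → Σ (List ℕ) λ S → (m ≡ P ++ (M ++ S)) × Shape u M
factor⇒block {u} s (p , _ , refl) with shape-drop-prefix p s
... | P , _ , refl , s′ with shape-take-prefix u s′
... | M , S , refl , t = P , M , S , refl , t

shape-uncons : ∀ {w z m} → Shape w (z ∷ m) →
               m ≡ [] ⊎ Σ Letter λ c → Σ Word λ w′ → (w ≡ c ∷ w′) × Shape w′ m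
shape-uncons (end _)        = inj₁ refl
shape-uncons (least _ s)    = inj₂ (a , _ , refl , s)
shape-uncons (greatest _ s) = inj₂ (b , _ , refl , s)

shape-suffix : ∀ P {r R w} → Shape w (P ++ r ∷ R) →
               Σ Word λ p → Σ Word λ v → (w ≡ p ++ v) × Shape v (r ∷ R)
shape-suffix []      s = [] , _ , refl , s
shape-suffix (_ ∷ P) s with shape-uncons s
... | inj₁ empty with () ← ++-conicalʳ P _ empty
... | inj₂ (c , _ , refl , s′) with shape-suffix P s′
...   | p , v , refl , t = c ∷ p , v , refl , t

shape-prefix : ∀ x M {S w} → Shape w (x ∷ M ++ S) →
               Σ Word λ u → Σ Word λ s → (w ≡ u ++ s) × Shape u (x ∷ M)
shape-prefix x []      s = [] , _ , refl , end x
shape-prefix x (y ∷ M) (least x<m s)    with shape-prefix y M s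
... | u , t , refl , s′ = a ∷ u , t , refl , least (++⁻ˡ (y ∷ M) x<m) s′
shape-prefix x (y ∷ M) (greatest m<x s) with shape-prefix y M s
... | u , t , refl , s′ = b ∷ u , t , refl , greatest (++⁻ˡ (y ∷ M) m<x) s′

block⇒factor : ∀ {w} P x M S → Shape w (P ++ (x ∷ M) ++ S) →
               Σ Word λ u → (u ≤F w) × Shape u (x ∷ M)
block⇒factor P x M S s with shape-suffix P s
... | p , _ , refl , t with shape-prefix x M t
... | u , r , refl , t′ = u , (p , r , refl) , t′

shape-subseq-head : ∀ {w π x xs} → Shape w π → (x ∷ xs) ⊆ π → All (x <_) xs ⊎ All (_< x) xs
shape-subseq-head (end _)           (_ ∷ʳ ())
shape-subseq-head (end _)           (refl ∷ []) = inj₁ []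
shape-subseq-head (least _ s)       (_ ∷ʳ sub)  = shape-subseq-head s sub
shape-subseq-head (greatest _ s)    (_ ∷ʳ sub)  = shape-subseq-head s sub
shape-subseq-head (least x<m _)     (refl ∷ sub) = inj₁ (All-resp-⊆ sub x<m)
shape-subseq-head (greatest m<x _)  (refl ∷ sub) = inj₂ (All-resp-⊆ sub m<x)

shape-avoids : ∀ {w π} → Shape w π → ∀ y r → y ≢ 1 → y ≢ suc (length r) → Avoids π (y ∷ r)
shape-avoids s y r y≢1 y≢top ([] , _ , ())
shape-avoids s y r y≢1 y≢top (x ∷ xs , sub , e) with shape-subseq-head s sub
... | inj₁ x<xs = y≢1 (sym (∷-injectiveˡ (trans (sym (std-least-head x xs x<xs)) e)))
... | inj₂ xs<x = y≢top (begin
  y                  ≡⟨ ∷-injectiveˡ e′ ⟨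
  suc (length xs)    ≡⟨ cong suc (length-map _ xs) ⟨
  suc (length (std xs)) ≡⟨ cong (suc ∘ length) (∷-injectiveʳ e′) ⟩
  suc (length r)     ∎)
  where
  open ≡-Reasoning
  e′ : suc (length xs) ∷ std xs ≡ y ∷ r
  e′ = trans (sym (std-greatest-head x xs xs<x)) e

-- f w lies in the subposet: it is a permutation of 1..n, and it avoids 213
-- and 231 since both patterns start with 2, which is neither 1 nor 3.
f-in-Av : ∀ w → InAv (f w)
f-in-Av w = (f-perm , f-nonempty)
          , shape-avoids (shape-f w) 2 _ (λ ()) (λ ())
          , shape-avoids (shape-f w) 2 _ (λ ()) (λ ())
  where
  n = suc (length w)
  f-perm : IsPerm (f w)
  f-perm = begin
    f w                               ↭⟨ F-perm w 1 ⟩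
    range 1 n                         ≡⟨ upTo-range n ⟨
    map suc (upTo n)                  ≡⟨ cong (map suc ∘ upTo) (length-fAux w 1 n) ⟨
    map suc (upTo (length (f w)))     ∎
    where open PermutationReasoning
  f-nonempty : 0 < length (f w)
  f-nonempty = subst (0 <_) (sym (length-fAux w 1 n)) (s≤s z≤n)

-- f is injective because a list has only one shape.
f-injective : (u w : Word) → f u ≡ f w → u ≡ w
f-injective u w fu≡fw = shape-unique (shape-f u) (subst (Shape w) (sym fu≡fw) (shape-f w))

avoids-⊆ : ∀ {π ρ p} → π ⊆ ρ → Avoids ρ p → Avoids π p
avoids-⊆ π⊆ρ avoids (xs , xs⊆π , e) = avoids (xs , ⊆-trans xs⊆π π⊆ρ , e)

AvoidsBoth : List ℕ → Set
AvoidsBoth π = Avoids π p213 × Avoids π p231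

avoids-tail : ∀ {x π} → AvoidsBoth (x ∷ π) → AvoidsBoth π
avoids-tail (no213 , no231) = avoids-⊆ (_ ∷ʳ ⊆-refl) no213 , avoids-⊆ (_ ∷ʳ ⊆-refl) no231

ordered-pair : ∀ {x y : ℕ} {ys} → x ∈ ys → y ∈ ys → x ≢ y → (x ∷ y ∷ []) ⊆ ys ⊎ (y ∷ x ∷ []) ⊆ ys
ordered-pair (here refl) (here refl) x≢y = ⊥-elim (x≢y refl)
ordered-pair (here refl) (there y∈)  _   = inj₁ (refl ∷ from∈ y∈)
ordered-pair (there x∈)  (here refl) _   = inj₂ (refl ∷ from∈ x∈)
ordered-pair (there x∈)  (there y∈)  x≢y with ordered-pair x∈ y∈ x≢y
... | inj₁ sub = inj₁ (_ ∷ʳ sub)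
... | inj₂ sub = inj₂ (_ ∷ʳ sub)

avoider-head : ∀ {x lo hi π} → AvoidsBoth (x ∷ π) → lo ∈ π → hi ∈ π → lo < x → x < hi → ⊥
avoider-head (no213 , no231) lo∈ hi∈ lo<x x<hi with ordered-pair lo∈ hi∈ (<⇒≢ (<-trans lo<x x<hi))
... | inj₁ sub = no213 (_ , refl ∷ sub , std-213 lo<x x<hi)
... | inj₂ sub = no231 (_ , refl ∷ sub , std-231 lo<x x<hi)

interval-head : ∀ {x π} lo k → x ∷ π ↭ range lo (suc (suc k)) → AvoidsBoth (x ∷ π) →
                x ≡ lo ⊎ x ≡ lo + suc k
interval-head {x} {π} lo k p av with lo ≟ x | x ≟ lo + suc k
... | yes refl | _          = inj₁ refl
... | no _     | yes x≡top  = inj₂ x≡top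
... | no lo≢x  | no x≢top   =
  ⊥-elim (avoider-head av (later (here refl) lo≢x) (later top∈ (≢-sym x≢top)) lo<x x<top)
  where
  top = lo + suc k
  x-bounds : lo ≤ x × x < lo + suc (suc k)
  x-bounds = range-∈ lo (suc (suc k)) (∈-resp-↭ p (here refl))
  lo<x : lo < x
  lo<x = ≤∧≢⇒< (proj₁ x-bounds) lo≢x
  x<top : x < top
  x<top = ≤∧≢⇒< (s≤s⁻¹ (subst (x <_) (+-suc lo (suc k)) (proj₂ x-bounds))) x≢top
  top∈ : top ∈ range lo (suc (suc k))
  top∈ = ∈-range lo (suc (suc k)) (m≤m+n lo (suc k)) (+-monoʳ-< lo (n<1+n (suc k)))
  later : ∀ {y} → y ∈ range lo (suc (suc k)) → y ≢ x → y ∈ π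
  later y∈ y≢x with ∈-resp-↭ (↭-sym p) y∈
  ... | here y≡x = ⊥-elim (y≢x y≡x)
  ... | there y∈π = y∈π

interval-avoider : ∀ k lo {π} → π ↭ range lo (suc k) → AvoidsBoth π →
                   Σ Word λ w → length w ≡ k × F w lo ≡ π
interval-avoider zero    lo p _ = [] , refl , sym (↭-singleton-inv p)
interval-avoider (suc k) lo {[]} p _ with () ← ↭-length p
interval-avoider (suc k) lo {x ∷ π} p av with interval-head lo k p av
... | inj₁ refl with interval-avoider k (suc lo) (drop-∷ p) (avoids-tail av)
...   | w , refl , Fw≡π = a ∷ w , refl , trans (F-a w lo) (cong (lo ∷_) Fw≡π)
interval-avoider (suc k) lo {x ∷ π} p av | inj₂ refl
  with interval-avoider k lo (drop-last (subst (x ∷ π ↭_) (range-snoc lo (suc k)) p)) (avoids-tail av)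
...   | w , refl , Fw≡π = b ∷ w , refl , trans (F-b w lo) (cong (x ∷_) Fw≡π)

f-surjective : (π : List ℕ) → InAv π → Σ Word λ w → f w ≡ π
f-surjective []      ((_ , ()) , _)
f-surjective (x ∷ π) ((perm , _) , av)
  with interval-avoider (length π) 1 (subst (x ∷ π ↭_) (upTo-range _) perm) av
... | w , _ , fw≡π = w , fw≡π

factor⇒pattern : (u w : Word) → u ≤F w → f u ≤C f w
factor⇒pattern u w u≤w with factor⇒block (shape-f w) u≤w
... | P , M , S , fw≡ , t = P , M , S , fw≡ , std-shape t

-- A block of f w with standard form f u is shaped by a factor v of w, and
-- std of that block is f v, so v = u by injectivity.
pattern⇒factor : (u w : Word) → f u ≤C f w → u ≤F w
pattern⇒factor u w (P , [] , S , _ , []≡fu) with () ← subst (Shape u) (sym []≡fu) (shape-f u)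
pattern⇒factor u w (P , x ∷ M , S , fw≡ , std≡fu)
  with block⇒factor P x M S (subst (Shape w) fw≡ (shape-f w))
... | v , v≤w , t with f-injective v u (trans (sym (std-shape t)) std≡fu)
... | refl = v≤w

proposition3p2 : ((w : Word) → InAv (f w))
    × ((u w : Word) → f u ≡ f w → u ≡ w)
    × ((π : List ℕ) → InAv π → Σ Word λ w → f w ≡ π)
    × ((u w : Word) → (u ≤F w) ⇔ (f u ≤C f w))
proposition3p2 =
  f-in-Av , f-injective , f-surjective , λ u w → mk⇔ (factor⇒pattern u w) (pattern⇒factor u w)
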